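{- Let $G$ be a connected graph with $n$ vertices, $m$ edges and cyclomatic number $\gamma$. (1) If $n_1(G)=0$ and $0<n_i(G)<n$ for some $3\le i\le n-1$, then $m_{i,i}(G)\le n_i(G)-2+\gamma$. (2) If $n_1(G)\ge 1$ and $0<n_i(G)<n$ for some $3\le i\le n-1$, then $m_{i,i}(G)\le n_i(G)-1+\gamma$.
   Context: All graphs are finite, simple and undirected. The cyclomatic number of a connected graph with $n$ vertices and $m$ edges is $\gamma=m-n+1$. $n_i(G)$ is the number of vertices of degree $i$ in $G$, and $m_{i,j}(G)$ is the number of edges of $G$ joining a vertex of degree $i$ to a vertex of degree $j$. -}

module Defs where

open import Data.Nat using (ℕ; zero; suc; _+_; _≡ᵇ_; _<ᵇ_)
open import Data.Bool using (Bool; true; false; if_then_else_; _∧_; _∨_)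
open import Data.Fin using (Fin; toℕ) renaming (zero to fzero; suc to fsuc)
open import Data.Integer using (ℤ; +_; _-_)
open import Relation.Binary.PropositionalEquality using (_≡_)

record Graph (n : ℕ) : Set where
  field
    adj    : Fin n → Fin n → Bool
    adj-sym    : ∀ u v → adj u v ≡ adj v u
    adj-irrefl : ∀ v → adj v v ≡ false
open Graph public

count : ∀ {n} → (Fin n → Bool) → ℕ
count {zero}  f = 0
count {suc n} f = (if f fzero then 1 else 0) + count (λ x → f (fsuc x))

sumFin : ∀ {n} → (Fin n → ℕ) → ℕ
sumFin {zero}  f = 0
sumFin {suc n} f = f fzero + sumFin (λ x → f (fsuc x))

data Reach {n} (G : Graph n) : Fin n → Fin n → Set where
  here : ∀ {u} → Reach G u u
  step : ∀ {u v w} → adj G u v ≡ true → Reach G v w → Reach G u w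

Connected : ∀ {n} → Graph n → Set
Connected G = ∀ u v → Reach G u v

degree : ∀ {n} → Graph n → Fin n → ℕ
degree G v = count (adj G v)

-- number of edges (unordered pairs {u,v}, counted once via toℕ u < toℕ v)
edgesWhere : ∀ {n} → Graph n → (Fin n → Fin n → Bool) → ℕ
edgesWhere G P = sumFin (λ u → count (λ v → (toℕ u <ᵇ toℕ v) ∧ adj G u v ∧ P u v))

numEdges : ∀ {n} → Graph n → ℕ
numEdges G = edgesWhere G (λ _ _ → true)

nDeg : ∀ {n} → Graph n → ℕ → ℕ
nDeg G i = count (λ v → degree G v ≡ᵇ i)

mDeg : ∀ {n} → Graph n → ℕ → ℕ → ℕ
mDeg G i j = edgesWhere G (λ u v →
  ((degree G u ≡ᵇ i) ∧ (degree G v ≡ᵇ j)) ∨ ((degree G u ≡ᵇ j) ∧ (degree G v ≡ᵇ i)))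

cyclomatic : ∀ {n} → Graph n → ℤ
cyclomatic {n} G = (+ numEdges G) - (+ n) Data.Integer.+ (+ 1)

module Submission where

-- Let S be the set of vertices of degree i.  Both bounds follow from one fact
-- about an arbitrary nonempty vertex set S of a connected graph G:
--
--   (★)  the number of edges not lying inside S is at least |V ∖ S|, and at
--        least |V ∖ S| + 1 when V ∖ S is nonempty and G has no leaves.
--
-- Indeed m = m_{i,i} + #(edges not inside S) and n = n_i + |V ∖ S|, so (★)
-- gives m_{i,i} ≤ n_i - 1 + γ, resp. m_{i,i} ≤ n_i - 2 + γ.
--
-- To prove (★), rank the vertices by their distance from S (ties broken by
-- index) and give every vertex outside S its edges to lower-ranked vertices
-- ("down edges").  Each vertex outside S has a neighbour strictly closer to S,
-- hence a down edge, and no edge is a down edge for both of its ends, nor for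
-- an edge inside S.  If there are no leaves, the top-ranked vertex lies outside
-- S and all its at least two edges are down edges, giving the extra 1.

open import Defs
open import Data.Nat using (ℕ; _≤_; _<_; _∸_)
open import Data.Integer using (+_; _-_) renaming (_+_ to _+ℤ_; _≤_ to _≤ℤ_)
open import Data.Product using (_×_)
open import Relation.Binary.PropositionalEquality using (_≡_)

open import Data.Nat using (zero; suc; _+_; _*_; z≤n; s≤s; _≡ᵇ_; _<ᵇ_; _≤?_)
open import Data.Nat.Properties
  using ( ≤-refl; ≤-trans; <-irrefl; <⇒≤; ≤-pred; ≰⇒>; ≤∧≢⇒<; <-≤-trans; <-cmp
        ; +-assoc; +-suc; +-mono-≤; +-monoʳ-≤; +-monoʳ-<; +-comm; +-cancelˡ-≡
        ; *-monoˡ-≤; m≤m+n; m≤n+m; n≤0⇒n≡0; <⇒<ᵇ; <ᵇ⇒<; module ≤-Reasoning )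
open import Data.Nat.Tactic.RingSolver using (solve-∀)
open import Data.Integer using (0ℤ; +≤+; _⊖_)
open import Data.Integer.Properties using (m-n≡m⊖n; ≤-⊖; 0≤i-j⇒j≤i)
import Data.Integer.Tactic.RingSolver as ℤ-Solver
open import Data.Bool using (Bool; true; false; if_then_else_; _∧_; _∨_; not; T)
open import Data.Bool.Properties using (∨-zeroʳ; ∨-idem)
open import Data.Fin using (Fin; toℕ) renaming (zero to fzero; suc to fsuc)
open import Data.Fin.Properties using (toℕ<n; toℕ-injective)
open import Data.Product using (Σ; _,_; proj₁; proj₂)
open import Data.Empty using (⊥-elim)
open import Relation.Binary.Definitions using (tri<; tri≈; tri>)
open import Relation.Binary.PropositionalEquality
  using (_≢_; refl; sym; trans; cong; cong₂; subst; subst₂; module ≡-Reasoning)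
open import Relation.Nullary using (yes; no)

indicator : Bool → ℕ
indicator b = if b then 1 else 0

indicator≤1 : ∀ b → indicator b ≤ 1
indicator≤1 true  = ≤-refl
indicator≤1 false = z≤n

T⇒≡true : ∀ {b} → T b → b ≡ true
T⇒≡true {true} _ = refl

∧-true : ∀ {a b} → a ∧ b ≡ true → (a ≡ true) × (b ≡ true)
∧-true {true} {true} _ = refl , refl

<ᵇ-asym : ∀ x y → (x <ᵇ y) ≡ true → (y <ᵇ x) ≡ false
<ᵇ-asym zero    (suc y) _ = refl
<ᵇ-asym (suc x) (suc y) e = <ᵇ-asym x y e

sumFin-+ : ∀ {n} (f g : Fin n → ℕ) → sumFin (λ x → f x + g x) ≡ sumFin f + sumFin g
sumFin-+ {zero}  f g = refl
sumFin-+ {suc n} f g = begin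
    f fzero + g fzero + sumFin (λ x → f (fsuc x) + g (fsuc x))
  ≡⟨ cong (λ s → f fzero + g fzero + s) (sumFin-+ (λ x → f (fsuc x)) (λ x → g (fsuc x))) ⟩
    f fzero + g fzero + (sumFin (λ x → f (fsuc x)) + sumFin (λ x → g (fsuc x)))
  ≡⟨ interchange (f fzero) (g fzero) _ _ ⟩
    f fzero + sumFin (λ x → f (fsuc x)) + (g fzero + sumFin (λ x → g (fsuc x)))
  ∎
  where
  open ≡-Reasoning
  interchange : ∀ a b c d → a + b + (c + d) ≡ a + c + (b + d)
  interchange = solve-∀

sumFin-cong : ∀ {n} {f g : Fin n → ℕ} → (∀ x → f x ≡ g x) → sumFin f ≡ sumFin g
sumFin-cong {zero}  _  = refl
sumFin-cong {suc n} fg = cong₂ _+_ (fg fzero) (sumFin-cong (λ x → fg (fsuc x)))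

sumFin-mono : ∀ {n} {f g : Fin n → ℕ} → (∀ x → f x ≤ g x) → sumFin f ≤ sumFin g
sumFin-mono {zero}  _  = z≤n
sumFin-mono {suc n} fg = +-mono-≤ (fg fzero) (sumFin-mono (λ x → fg (fsuc x)))

sumFin-strict : ∀ {n} {f g : Fin n → ℕ} → (∀ x → f x ≤ g x) →
  ∀ w → f w < g w → sumFin f < sumFin g
sumFin-strict {suc n} fg fzero    fw<gw = +-mono-≤ fw<gw (sumFin-mono (λ x → fg (fsuc x)))
sumFin-strict {suc n} {f} {g} fg (fsuc w) fw<gw =
  subst (_≤ sumFin g) (+-suc (f fzero) _) (+-mono-≤ (fg fzero) (sumFin-strict (λ x → fg (fsuc x)) w fw<gw))

count-as-sum : ∀ {n} (f : Fin n → Bool) → count f ≡ sumFin (λ x → indicator (f x))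
count-as-sum {zero}  f = refl
count-as-sum {suc n} f = cong (λ s → indicator (f fzero) + s) (count-as-sum (λ x → f (fsuc x)))

count-pos : ∀ {n} (f : Fin n → Bool) x → f x ≡ true → 0 < count f
count-pos f x fx = begin-strict
    0                          <⟨ subst (λ b → 0 < indicator b) (sym fx) ≤-refl ⟩
    indicator (f x)            ≤⟨ sumFin-single x ⟩
    sumFin (λ y → indicator (f y)) ≡⟨ sym (count-as-sum f) ⟩
    count f                    ∎
  where
  open ≤-Reasoning
  sumFin-single : ∀ {n} {g : Fin n → ℕ} x → g x ≤ sumFin g
  sumFin-single {g = g} fzero    = m≤m+n (g fzero) _
  sumFin-single {g = g} (fsuc x) = ≤-trans (sumFin-single x) (m≤n+m _ (g fzero))

count-witness : ∀ {n} (f : Fin n → Bool) → 0 < count f → Σ (Fin n) λ x → f x ≡ true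
count-witness {suc n} f pos with f fzero in fz
... | true  = fzero , fz
... | false with count-witness (λ y → f (fsuc y)) pos
...   | x , fx = fsuc x , fx

count-miss : ∀ {n} (f : Fin n → Bool) → count f < n → Σ (Fin n) λ x → f x ≡ false
count-miss {suc n} f lt with f fzero in fz
... | false = fzero , fz
... | true with count-miss (λ y → f (fsuc y)) (≤-pred lt)
...   | x , fx = fsuc x , fx

count-zero : ∀ {n} (f : Fin n → Bool) → count f ≡ 0 → ∀ x → f x ≡ false
count-zero f none x with f x in fx
... | false = refl
... | true  = ⊥-elim (<-irrefl (sym none) (count-pos f x fx))

count-compl : ∀ {n} (f : Fin n → Bool) → count f + count (λ x → not (f x)) ≡ n
count-compl {zero}  f = refl
count-compl {suc n} f with f fzero
... | true  = cong suc (count-compl (λ y → f (fsuc y)))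
... | false = trans (+-suc _ _) (cong suc (count-compl (λ y → f (fsuc y))))

count-mono : ∀ {n} {f g : Fin n → Bool} → (∀ x → f x ≡ true → g x ≡ true) → count f ≤ count g
count-mono {f = f} {g} f⇒g = begin
    count f                         ≡⟨ count-as-sum f ⟩
    sumFin (λ x → indicator (f x))  ≤⟨ sumFin-mono (λ x → pointwise (f x) (g x) (f⇒g x)) ⟩
    sumFin (λ x → indicator (g x))  ≡⟨ sym (count-as-sum g) ⟩
    count g                         ∎
  where
  open ≤-Reasoning
  pointwise : ∀ a b → (a ≡ true → b ≡ true) → indicator a ≤ indicator b
  pointwise false b _   = z≤n
  pointwise true  b a⇒b rewrite a⇒b refl = ≤-refl

count-cong : ∀ {n} {f g : Fin n → Bool} → (∀ x → f x ≡ g x) → count f ≡ count g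
count-cong {f = f} {g} f≡g =
  trans (count-as-sum f) (trans (sumFin-cong (λ x → cong indicator (f≡g x))) (sym (count-as-sum g)))

count-+ : ∀ {n} (h f g : Fin n → Bool) →
  (∀ x → indicator (h x) ≡ indicator (f x) + indicator (g x)) → count h ≡ count f + count g
count-+ h f g split = begin
    count h                                                ≡⟨ count-as-sum h ⟩
    sumFin (λ x → indicator (h x))                         ≡⟨ sumFin-cong split ⟩
    sumFin (λ x → indicator (f x) + indicator (g x))       ≡⟨ sumFin-+ (λ x → indicator (f x)) (λ x → indicator (g x)) ⟩
    sumFin (λ x → indicator (f x)) + sumFin (λ x → indicator (g x))
      ≡⟨ sym (cong₂ _+_ (count-as-sum f) (count-as-sum g)) ⟩
    count f + count g                                      ∎
  where open ≡-Reasoning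

edgesWhere-cong : ∀ {n} (G : Graph n) {P Q : Fin n → Fin n → Bool} →
  (∀ u v → P u v ≡ Q u v) → edgesWhere G P ≡ edgesWhere G Q
edgesWhere-cong G P≡Q =
  sumFin-cong λ u → count-cong λ v → cong (λ b → (toℕ u <ᵇ toℕ v) ∧ adj G u v ∧ b) (P≡Q u v)

edgesWhere-split : ∀ {n} (G : Graph n) (P : Fin n → Fin n → Bool) →
  numEdges G ≡ edgesWhere G P + edgesWhere G (λ u v → not (P u v))
edgesWhere-split G P = trans
  (sumFin-cong λ u → count-+ _ _ _ λ v → split (toℕ u <ᵇ toℕ v) (adj G u v) (P u v))
  (sumFin-+ (λ u → count (λ v → (toℕ u <ᵇ toℕ v) ∧ adj G u v ∧ P u v))
            (λ u → count (λ v → (toℕ u <ᵇ toℕ v) ∧ adj G u v ∧ not (P u v))))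
  where
  split : ∀ a b p → indicator (a ∧ b ∧ true) ≡ indicator (a ∧ b ∧ p) + indicator (a ∧ b ∧ not p)
  split false _     _     = refl
  split true  false _     = refl
  split true  true  true  = refl
  split true  true  false = refl

-- With
-- g u v = adj G u v ∧ Q u v the right-hand side is edgesWhere G Q.  By
-- induction on n: the row f 0 v and column f u 0 of vertex 0 are bounded by
-- the pairs 0 < v, the remaining vertices by the induction hypothesis.
orientations≤pairs : ∀ {n} (f g : Fin n → Fin n → Bool) →
  (∀ u v → indicator (f u v) + indicator (f v u) ≤ indicator (g u v)) →
  (∀ v → f v v ≡ false) →
  sumFin (λ u → count (f u)) ≤ sumFin (λ u → count (λ v → (toℕ u <ᵇ toℕ v) ∧ g u v))
orientations≤pairs {zero}  f g once irrefl = z≤n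
orientations≤pairs {suc n} f g once irrefl = begin
    indicator (f fzero fzero) + row + sumFin (λ u → column u + count (f′ u))
  ≡⟨ cong (λ b → indicator b + row + sumFin (λ u → column u + count (f′ u))) (irrefl fzero) ⟩
    row + sumFin (λ u → column u + count (f′ u))
  ≡⟨ cong (λ s → row + s) (sumFin-+ column (λ u → count (f′ u))) ⟩
    row + (sumFin column + sumFin (λ u → count (f′ u)))
  ≡⟨ sym (+-assoc row (sumFin column) _) ⟩
    row + sumFin column + sumFin (λ u → count (f′ u))
  ≤⟨ +-mono-≤ firstRowAndColumn rest ⟩
    count (λ v → g fzero (fsuc v)) + sumFin (λ u → count (λ v → (toℕ u <ᵇ toℕ v) ∧ g′ u v))
  ∎
  where
  open ≤-Reasoning
  f′ g′ : Fin n → Fin n → Bool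
  f′ u v = f (fsuc u) (fsuc v)
  g′ u v = g (fsuc u) (fsuc v)
  row : ℕ
  row = count (λ v → f fzero (fsuc v))
  column : Fin n → ℕ
  column u = indicator (f (fsuc u) fzero)
  rest : sumFin (λ u → count (f′ u)) ≤ sumFin (λ u → count (λ v → (toℕ u <ᵇ toℕ v) ∧ g′ u v))
  rest = orientations≤pairs f′ g′ (λ u v → once (fsuc u) (fsuc v)) (λ v → irrefl (fsuc v))
  firstRowAndColumn : row + sumFin column ≤ count (λ v → g fzero (fsuc v))
  firstRowAndColumn = begin
      row + sumFin column
    ≡⟨ cong (λ s → s + sumFin column) (count-as-sum (λ v → f fzero (fsuc v))) ⟩
      sumFin (λ v → indicator (f fzero (fsuc v))) + sumFin column
    ≡⟨ sym (sumFin-+ (λ v → indicator (f fzero (fsuc v))) column) ⟩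
      sumFin (λ v → indicator (f fzero (fsuc v)) + column v)
    ≤⟨ sumFin-mono (λ v → once fzero (fsuc v)) ⟩
      sumFin (λ v → indicator (g fzero (fsuc v)))
    ≡⟨ sym (count-as-sum (λ v → g fzero (fsuc v))) ⟩
      count (λ v → g fzero (fsuc v))
    ∎

-- least p b is the least k with p k, provided p b holds (search bounded by b).
least : (ℕ → Bool) → ℕ → ℕ
least p zero    = 0
least p (suc b) = if p 0 then 0 else suc (least (λ k → p (suc k)) b)

least-holds : ∀ (p : ℕ → Bool) b → p b ≡ true → p (least p b) ≡ true
least-holds p zero    pb = pb
least-holds p (suc b) pb with p 0 in p0
... | true  = p0
... | false = least-holds (λ k → p (suc k)) b pb

least-minimal : ∀ (p : ℕ → Bool) b k → p k ≡ true → least p b ≤ k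
least-minimal p zero    k       pk = z≤n
least-minimal p (suc b) k       pk with p 0 in p0
least-minimal p (suc b) k       pk | true  = z≤n
least-minimal p (suc b) zero    pk | false with () ← trans (sym pk) p0
least-minimal p (suc b) (suc k) pk | false = s≤s (least-minimal (λ k → p (suc k)) b k pk)

argmax : ∀ {n} (key : Fin n → ℕ) → Fin n → Σ (Fin n) λ w → ∀ u → key u ≤ key w
argmax {suc zero}    key _ = fzero , λ { fzero → ≤-refl }
argmax {suc (suc n)} key _ with argmax (λ x → key (fsuc x)) fzero
... | w , wmax with key fzero ≤? key (fsuc w)
...   | yes k0≤kw = fsuc w , λ { fzero → k0≤kw ; (fsuc u) → wmax u }
...   | no  k0≰kw = fzero , λ { fzero → ≤-refl ; (fsuc u) → ≤-trans (wmax u) (<⇒≤ (≰⇒> k0≰kw)) }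

walkLength : ∀ {n} {G : Graph n} {u v} → Reach G u v → ℕ
walkLength here       = 0
walkLength (step _ r) = suc (walkLength r)

module DistanceFrom {n : ℕ} (G : Graph n) (conn : Connected G)
                    (S : Fin n → Bool) (root : Fin n) (root∈S : S root ≡ true) where

  -- within k v: v is joined to S by a walk of at most k edges.
  within : ℕ → Fin n → Bool
  within zero    v = S v
  within (suc k) v = within k v ∨ (0 <ᵇ count (λ u → adj G v u ∧ within k u))

  within-walk : ∀ {v} (r : Reach G v root) → within (walkLength r) v ≡ true
  within-walk here = root∈S
  within-walk {v} (step {v = w} vw r) =
    trans (cong (within (walkLength r) v ∨_) (T⇒≡true (<⇒<ᵇ neighbourWithin)))
          (∨-zeroʳ (within (walkLength r) v))
    where
    neighbourWithin : 0 < count (λ u → adj G v u ∧ within (walkLength r) u)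
    neighbourWithin = count-pos _ w (subst (λ b → b ∧ within (walkLength r) w ≡ true) (sym vw) (within-walk r))

  dist : Fin n → ℕ
  dist v = least (λ k → within k v) (walkLength (conn v root))

  dist-within : ∀ v → within (dist v) v ≡ true
  dist-within v = least-holds (λ k → within k v) (walkLength (conn v root)) (within-walk (conn v root))

  dist-minimal : ∀ v k → within k v ≡ true → dist v ≤ k
  dist-minimal v k = least-minimal (λ k → within k v) (walkLength (conn v root)) k

  -- Every vertex outside S has a neighbour strictly closer to S: its distance
  -- is some k + 1, it is not within k, so a neighbour is within k.
  closer-neighbour : ∀ v → S v ≡ false → Σ (Fin n) λ u → (adj G v u ≡ true) × (dist u < dist v)
  closer-neighbour v v∉S with dist v in dv | dist-within v
  ... | zero  | v∈S with () ← trans (sym v∈S) v∉S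
  ... | suc k | v-within with within k v in earlier
  ...   | true  = ⊥-elim (<-irrefl refl (subst (_≤ k) dv (dist-minimal v k earlier)))
  ...   | false with count-witness (λ u → adj G v u ∧ within k u) (<ᵇ⇒< 0 _ (subst T (sym v-within) _))
  ...     | u , vu = u , proj₁ (∧-true vu) , s≤s (dist-minimal u k (proj₂ (∧-true vu)))

  rank : Fin n → ℕ
  rank v = dist v * n + toℕ v

  rank-mono : ∀ u v → dist u < dist v → rank u < rank v
  rank-mono u v du<dv = begin-strict
      dist u * n + toℕ u  <⟨ +-monoʳ-< (dist u * n) (toℕ<n u) ⟩
      dist u * n + n      ≡⟨ +-comm (dist u * n) n ⟩
      suc (dist u) * n    ≤⟨ *-monoˡ-≤ n du<dv ⟩
      dist v * n          ≤⟨ m≤m+n (dist v * n) (toℕ v) ⟩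
      rank v              ∎
    where open ≤-Reasoning

  rank-injective : ∀ u v → rank u ≡ rank v → u ≡ v
  rank-injective u v same with <-cmp (dist u) (dist v)
  ... | tri< du<dv _ _ = ⊥-elim (<-irrefl same (rank-mono u v du<dv))
  ... | tri> _ _ dv<du = ⊥-elim (<-irrefl (sym same) (rank-mono v u dv<du))
  ... | tri≈ _ du≡dv _ = toℕ-injective (+-cancelˡ-≡ (dist u * n) (toℕ u) (toℕ v)
                           (trans same (cong (λ d → d * n + toℕ v) (sym du≡dv))))

  rank-inside : ∀ v → S v ≡ true → rank v < n
  rank-inside v v∈S = subst (λ d → d * n + toℕ v < n) (sym (n≤0⇒n≡0 (dist-minimal v 0 v∈S))) (toℕ<n v)

  rank-outside : ∀ v → S v ≡ false → n ≤ rank v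
  rank-outside v v∉S with closer-neighbour v v∉S
  ... | u , _ , du<dv = begin
      n                  ≤⟨ m≤m+n n (dist u * n) ⟩
      suc (dist u) * n   ≤⟨ *-monoˡ-≤ n du<dv ⟩
      dist v * n         ≤⟨ m≤m+n (dist v * n) (toℕ v) ⟩
      rank v             ∎
    where open ≤-Reasoning

  down : Fin n → Fin n → Bool
  down v u = adj G v u ∧ (not (S v) ∧ (rank u <ᵇ rank v))

  outside : Fin n → Fin n → Bool
  outside u v = not (S u ∧ S v)

  downEdges : ℕ
  downEdges = sumFin (λ v → count (down v))

  down-once : ∀ u v → indicator (down u v) + indicator (down v u) ≤ indicator (adj G u v ∧ outside u v)
  down-once u v rewrite adj-sym G v u with adj G u v
  ... | false = z≤n
  ... | true  = atMostOne (S u) (S v) (rank v <ᵇ rank u) (rank u <ᵇ rank v) (<ᵇ-asym (rank v) (rank u))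
    where
    atMostOne : ∀ a b x y → (x ≡ true → y ≡ false) →
      indicator (not a ∧ x) + indicator (not b ∧ y) ≤ indicator (not (a ∧ b))
    atMostOne true  true  x     y _ = z≤n
    atMostOne true  false x     y _ = indicator≤1 y
    atMostOne false true  true  y _ = ≤-refl
    atMostOne false true  false y _ = z≤n
    atMostOne false false true  y x⇒¬y rewrite x⇒¬y refl = ≤-refl
    atMostOne false false false y _ = indicator≤1 y

  downEdges≤outsideEdges : downEdges ≤ edgesWhere G outside
  downEdges≤outsideEdges = orientations≤pairs down (λ u v → adj G u v ∧ outside u v) down-once
    (λ v → cong (_∧ (not (S v) ∧ (rank v <ᵇ rank v))) (adj-irrefl G v))

  -- The edge to a closer neighbour is a down edge.
  outsider-has-down-edge : ∀ v → indicator (not (S v)) ≤ count (down v)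
  outsider-has-down-edge v = byMembership (S v) refl
    where
    byMembership : ∀ b → S v ≡ b → indicator (not b) ≤ count (down v)
    byMembership true  _   = z≤n
    byMembership false v∉S with closer-neighbour v v∉S
    ... | u , vu , du<dv = count-pos (down v) u isDown
      where
      isDown : down v u ≡ true
      isDown rewrite vu | v∉S = T⇒≡true (<⇒<ᵇ (rank-mono u v du<dv))

  outsiders≤outsideEdges : count (λ v → not (S v)) ≤ edgesWhere G outside
  outsiders≤outsideEdges = begin
    count (λ v → not (S v))                      ≡⟨ count-as-sum (λ v → not (S v)) ⟩
    sumFin (λ v → indicator (not (S v)))         ≤⟨ sumFin-mono outsider-has-down-edge ⟩
    downEdges                                    ≤⟨ downEdges≤outsideEdges ⟩
    edgesWhere G outside                         ∎
    where open ≤-Reasoning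

  -- (★), second part: the top-ranked vertex lies outside S, and all of its
  -- edges, at least two when there are no leaves, are down edges.
  outsiders<outsideEdges : (∀ v → (degree G v ≡ᵇ 1) ≡ false) → ∀ t → S t ≡ false →
    count (λ v → not (S v)) < edgesWhere G outside
  outsiders<outsideEdges noLeaf t t∉S = begin-strict
    count (λ v → not (S v))                      ≡⟨ count-as-sum (λ v → not (S v)) ⟩
    sumFin (λ v → indicator (not (S v)))         <⟨ sumFin-strict outsider-has-down-edge top top-two ⟩
    downEdges                                    ≤⟨ downEdges≤outsideEdges ⟩
    edgesWhere G outside                         ∎
    where
    open ≤-Reasoning
    top : Fin n
    top = proj₁ (argmax rank t)
    top-max : ∀ u → rank u ≤ rank top
    top-max = proj₂ (argmax rank t)
    top∉S : S top ≡ false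
    top∉S with S top in top∈S
    ... | false = refl
    ... | true  = ⊥-elim (<-irrefl refl
                    (<-≤-trans (rank-inside top top∈S) (≤-trans (rank-outside t t∉S) (top-max t))))
    all-down : ∀ u → adj G top u ≡ true → down top u ≡ true
    all-down u tu rewrite tu | top∉S = T⇒≡true (<⇒<ᵇ (≤∧≢⇒< (top-max u) u≢top))
      where
      u≢top : rank u ≢ rank top
      u≢top same with rank-injective u top same
      ... | refl with () ← trans (sym tu) (adj-irrefl G top)
    degree≥2 : 2 ≤ degree G top
    degree≥2 with closer-neighbour top top∉S
    ... | u , tu , _ = notOne (degree G top) (count-pos (adj G top) u tu) (noLeaf top)
      where
      notOne : ∀ d → 1 ≤ d → (d ≡ᵇ 1) ≡ false → 2 ≤ d
      notOne (suc (suc d)) _ _ = s≤s (s≤s z≤n)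
    top-two : indicator (not (S top)) < count (down top)
    top-two = subst (λ b → indicator (not b) < count (down top)) (sym top∉S)
                (≤-trans degree≥2 (count-mono all-down))

excess-bound : ∀ {n} (G : Graph n) (a e s t c : ℕ) →
  a + e ≡ numEdges G → s + t ≡ n → c + t ≤ suc e →
  (+ a) ≤ℤ ((+ s) - (+ c)) +ℤ cyclomatic G
excess-bound {n} G a e s t c edges vertices slack =
  0≤i-j⇒j≤i (subst (0ℤ ≤ℤ_) (sym gap) (+≤+ z≤n))
  where
  m : ℕ
  m = numEdges G
  counted : a + n + c ≤ s + m + 1
  counted = subst₂ (λ N M → a + N + c ≤ s + M + 1) vertices edges
    (subst₂ _≤_ (left a s t c) (right a s e) (+-monoʳ-≤ (a + s) slack))
    where
    left : ∀ a s t c → a + s + (c + t) ≡ a + (s + t) + c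
    left = solve-∀
    right : ∀ a s e → a + s + suc e ≡ s + (a + e) + 1
    right = solve-∀
  gap : ((+ s) - (+ c)) +ℤ cyclomatic G - (+ a) ≡ + (s + m + 1 ∸ (a + n + c))
  gap = begin
      ((+ s) - (+ c)) +ℤ (((+ m) - (+ n)) +ℤ (+ 1)) - (+ a)
    ≡⟨ regroup (+ s) (+ c) (+ m) (+ n) (+ a) ⟩
      (+ s +ℤ + m +ℤ + 1) - (+ a +ℤ + n +ℤ + c)
    ≡⟨ m-n≡m⊖n (s + m + 1) (a + n + c) ⟩
      (s + m + 1) ⊖ (a + n + c)
    ≡⟨ ≤-⊖ counted ⟩
      + (s + m + 1 ∸ (a + n + c))
    ∎
    where
    open ≡-Reasoning
    regroup : ∀ s c m n a →
      ((s - c) +ℤ ((m - n) +ℤ + 1)) - a ≡ (s +ℤ m +ℤ + 1) - (a +ℤ n +ℤ c)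
    regroup = ℤ-Solver.solve-∀

-- S is the set of vertices of degree i; it is nonempty and not everything.
-- The second bound holds in every connected graph; leaves are only excluded
-- to obtain the stronger first bound.
lemma2p5 : ∀ {n : ℕ} (G : Graph n) → Connected G → (i : ℕ) →
    3 ≤ i → i ≤ n ∸ 1 → 0 < nDeg G i → nDeg G i < n →
    (nDeg G 1 ≡ 0 → (+ mDeg G i i) ≤ℤ ((+ nDeg G i) - (+ 2)) +ℤ cyclomatic G)
    × (1 ≤ nDeg G 1 → (+ mDeg G i i) ≤ℤ ((+ nDeg G i) - (+ 1)) +ℤ cyclomatic G)
lemma2p5 {n} G conn i _ _ someOfDegree notAllOfDegree = noLeafBound , bound
  where
  S : Fin n → Bool
  S v = degree G v ≡ᵇ i
  root : Σ (Fin n) λ v → S v ≡ true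
  root = count-witness S someOfDegree
  outsider : Σ (Fin n) λ v → S v ≡ false
  outsider = count-miss S notAllOfDegree
  open DistanceFrom G conn S (proj₁ root) (proj₂ root)
  inside : Fin n → Fin n → Bool
  inside u v = S u ∧ S v
  edges : mDeg G i i + edgesWhere G outside ≡ numEdges G
  edges = trans (cong (λ k → k + edgesWhere G outside) (edgesWhere-cong G (λ u v → ∨-idem (inside u v))))
                (sym (edgesWhere-split G inside))
  vertices : nDeg G i + count (λ v → not (S v)) ≡ n
  vertices = count-compl S
  noLeafBound : nDeg G 1 ≡ 0 → (+ mDeg G i i) ≤ℤ ((+ nDeg G i) - (+ 2)) +ℤ cyclomatic G
  noLeafBound noLeaves = excess-bound G _ _ _ _ 2 edges vertices
    (s≤s (outsiders<outsideEdges (count-zero _ noLeaves) (proj₁ outsider) (proj₂ outsider)))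
  bound : 1 ≤ nDeg G 1 → (+ mDeg G i i) ≤ℤ ((+ nDeg G i) - (+ 1)) +ℤ cyclomatic G
  bound _ = excess-bound G _ _ _ _ 1 edges vertices (s≤s outsiders≤outsideEdges)
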